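{- For every caterpillar $T$, \[U_T(x_1=0,x_2,x_3,\ldots)=U^L_T(x_1=0,x_2,x_3,\ldots).\] Furthermore, if $T$ is proper, then $U^L_T$ does not depend on $x_1$; in particular, in that case $U^L_T$ is an evaluation of the $U$-polynomial of $T$ (namely $U^L_T(\mathbf{x})=U_T(0,x_2,x_3,\ldots)$).
   Context: Let $\mathbf{x}=x_1,x_2,\ldots$ be commuting indeterminates; for a partition $\lambda=\lambda_1\cdots\lambda_l$ write $\mathbf{x}_\lambda=x_{\lambda_1}\cdots x_{\lambda_l}$. For a tree $T=(V,E)$ and $A\subseteq E$, let $T|_A$ be the spanning subgraph $(V,A)$ and $\lambda(A)$ the partition of $|V|$ formed by the sizes of the connected components of $T|_A$. For a tree, the $U$-polynomial (weighted graph polynomial of Noble and Welsh) is $U_T(\mathbf{x})=\sum_{A\subseteq E}\mathbf{x}_{\lambda(A)}$. A caterpillar is a tree whose internal vertices induce a non-trivial path $P(T)$ (the spine); identify $P(T)$ with its edge set and let $L(T)=E\setminus P(T)$ be the set of leaf-edges. A caterpillar is proper if every internal vertex is adjacent to at least one leaf. The restricted weighted polynomial of a caterpillar $T$ is $U^L_T(\mathbf{x})=\sum_{A\subseteq E,\ L(T)\subseteq A}\mathbf{x}_{\lambda(A)}$. -}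

module Defs where

open import Data.Nat using (ℕ; zero; suc; _≤_; _≥_; _<ᵇ_)
open import Data.Bool using (Bool; true; false; _∨_; _∧_; not; if_then_else_; T)
open import Data.Fin using (Fin; toℕ; _≟_)
open import Data.Fin.Subset using (Subset; ⁅_⁆; ∣_∣)
open import Data.Vec using (lookup; updateAt)
open import Data.Product using (_×_; _,_; ∃; Σ; proj₁; proj₂)
open import Data.List using (List; []; _∷_; _++_; map; length; foldr; allFin)
open import Data.Bool.ListAction using (all; any)
open import Data.List.Membership.Propositional using (_∈_; _∉_)
open import Data.List.Relation.Unary.All using (All)
open import Data.List.Relation.Unary.Unique.Propositional using (Unique)
open import Data.List.Relation.Binary.Permutation.Propositional using (↭-setoid)
import Data.List.Relation.Binary.Permutation.Setoid as PermS
open import Data.Sum using (_⊎_)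
open import Relation.Binary.PropositionalEquality using (_≡_)
open import Relation.Nullary using (¬_)
open import Relation.Nullary.Decidable using (⌊_⌋)
open import Function using (_⇔_)

boolFilter : ∀ {X : Set} → (X → Bool) → List X → List X
boolFilter p []       = []
boolFilter p (x ∷ xs) = if p x then x ∷ boolFilter p xs else boolFilter p xs

-- A monomial x_λ is represented by the list of its indices (a multiset of
-- positive naturals = a partition); a polynomial by the list of its
-- monomials (each with coefficient 1, repetitions add up).

Monomial : Set
Monomial = List ℕ

Poly : Set
Poly = List Monomial

-- Equality of polynomials: equal as multisets of monomials, where
-- monomials are themselves compared as multisets (commutativity).
_≈ₚ_ : Poly → Poly → Set
p ≈ₚ q = PermS._↭_ ↭-setoid p q

hasX1 : Monomial → Bool
hasX1 m = any (λ i → ⌊ Data.Nat._≟_ i 1 ⌋) m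

-- Evaluation at x₁ = 0: kill all monomials containing x₁.
evalX1≡0 : Poly → Poly
evalX1≡0 p = boolFilter (λ m → not (hasX1 m)) p

-- p does not depend on x₁: no monomial of p involves x₁
-- (coefficients are natural numbers, so there is no cancellation).
IndepX1 : Poly → Set
IndepX1 p = All (λ m → hasX1 m ≡ false) p

Edge : ℕ → Set
Edge n = Fin n × Fin n

Joins : ∀ {n} → Edge n → Fin n → Fin n → Set
Joins (a , b) u v = (a ≡ u × b ≡ v) ⊎ (a ≡ v × b ≡ u)

data Walk {n : ℕ} (F : List (Edge n)) : Fin n → Fin n → Set where
  here : ∀ {u} → Walk F u u
  step : ∀ {u v w} (e : Edge n) → e ∈ F → Joins e u v → Walk F v w → Walk F u w

Connected : ∀ {n} → List (Edge n) → Set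
Connected F = ∀ u v → Walk F u v

-- A tree: at least one vertex, connected, and exactly |V| - 1 edges
-- (standard equivalent definition of a tree).
record IsTree (n : ℕ) (E : List (Edge n)) : Set where
  field
    nonempty  : n ≥ 1
    connected : Connected E
    edgeCount : suc (length E) ≡ n

incidentᵇ : ∀ {n} → Fin n → Edge n → Bool
incidentᵇ v (a , b) = ⌊ a ≟ v ⌋ ∨ ⌊ b ≟ v ⌋

deg : ∀ {n} → List (Edge n) → Fin n → ℕ
deg E v = length (boolFilter (incidentᵇ v) E)

internalᵇ : ∀ {n} → List (Edge n) → Fin n → Bool
internalᵇ E v = 2 Data.Nat.≤ᵇ deg E v

Internal : ∀ {n} → List (Edge n) → Fin n → Set
Internal E v = 2 ≤ deg E v

spineᵇ : ∀ {n} → List (Edge n) → Edge n → Bool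
spineᵇ E (a , b) = internalᵇ E a ∧ internalᵇ E b

leafEdgeᵇ : ∀ {n} → List (Edge n) → Edge n → Bool
leafEdgeᵇ E e = not (spineᵇ E e)

data Consecutive {A : Set} : List A → A → A → Set where
  hd : ∀ {x y xs} → Consecutive (x ∷ y ∷ xs) x y
  tl : ∀ {x xs u v} → Consecutive xs u v → Consecutive (x ∷ xs) u v

-- The internal vertices of (Fin n, E) induce a non-trivial path:
-- there is a list of ≥ 2 distinct vertices, which are exactly the
-- internal vertices, such that the edges of E between internal vertices
-- are exactly the edges joining consecutive vertices of the list.
record IsCaterpillar (n : ℕ) (E : List (Edge n)) : Set where
  field
    tree      : IsTree n E
    spineList : List (Fin n)
    nontriv   : 2 ≤ length spineList
    distinct  : Unique spineList
    exactly   : ∀ v → (Internal E v ⇔ v ∈ spineList)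
    spineEdgesConsec : ∀ e → e ∈ E → spineᵇ E e ≡ true →
                       ∃ λ u → ∃ λ v → Consecutive spineList u v × Joins e u v
    consecEdges : ∀ u v → Consecutive spineList u v →
                  ∃ λ e → e ∈ E × Joins e u v

Proper : ∀ {n} → List (Edge n) → Set
Proper {n} E = ∀ v → Internal E v →
  ∃ λ (u : Fin n) → deg E u ≡ 1 × ∃ λ e → e ∈ E × Joins e v u

closeStep : ∀ {n} → List (Edge n) → Subset n → Subset n
closeStep A S = foldr add S A
  where
  add : _ → Subset _ → Subset _
  add (a , b) S' =
    if lookup S a ∨ lookup S b
    then updateAt (updateAt S' a (λ _ → true)) b (λ _ → true)
    else S'

iter : ∀ {A : Set} → ℕ → (A → A) → A → A
iter zero    f x = x
iter (suc k) f x = f (iter k f x)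

-- vertex set of the component of v (n closure steps suffice)
component : ∀ {n} → List (Edge n) → Fin n → Subset n
component {n} A v = iter n (closeStep A) ⁅ v ⁆

leaderᵇ : ∀ {n} → List (Edge n) → Fin n → Bool
leaderᵇ {n} A v =
  not (any (λ u → (toℕ u <ᵇ toℕ v) ∧ lookup (component A v) u) (allFin n))

compPartition : ∀ {n} → List (Edge n) → List ℕ
compPartition {n} A =
  map (λ v → ∣ component A v ∣) (boolFilter (leaderᵇ A) (allFin n))

-- Subsets of the edge list (sublists, by position: 2^|E| of them)

subsets : ∀ {X : Set} → List X → List (List X)
subsets []       = [] ∷ []
subsets (x ∷ xs) = map (x ∷_) (subsets xs) ++ subsets xs

containsLeavesᵇ : ∀ {n} → List (Edge n) → List (Edge n) → Bool
containsLeavesᵇ E A =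
  all (λ e → not (leafEdgeᵇ E e) ∨ any (λ f → edgeEqᵇ e f) A) E
  where
  edgeEqᵇ : _ → _ → Bool
  edgeEqᵇ (a , b) (c , d) = ⌊ a ≟ c ⌋ ∧ ⌊ b ≟ d ⌋

U : ∀ {n} → List (Edge n) → Poly
U E = map compPartition (subsets E)

UL : ∀ {n} → List (Edge n) → Poly
UL E = map compPartition (boolFilter (containsLeavesᵇ E) (subsets E))

module Submission where

-- The proof rests on two facts about a caterpillar T = (V, E):
--   (a) if A omits a leaf-edge e, then an endpoint of e is not internal, so e is
--       its only edge and it is an isolated vertex of (V, A): x₁ divides x_{λ(A)};
--   (b) if T is proper and A contains every leaf-edge, then every vertex lies on
--       a leaf-edge, hence on an edge of A, so every component of (V, A) has at
--       least two vertices and x₁ does not divide x_{λ(A)}.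
-- By (a) every term of U_T surviving x₁ = 0 comes from some A ⊇ L(T), which is
-- the first identity.  By (b), for proper T the condition "A ⊇ L(T)" coincides
-- with "x₁ ∤ x_{λ(A)}", which gives the second.  Both identities even hold as
-- equalities of term lists, so ≈ₚ follows by reflexivity.

open import Defs
open import Data.Nat using (ℕ; zero; suc; _≤_; _≤ᵇ_; _<ᵇ_; _≟_; s≤s; z≤n)
open import Data.Nat.Properties using (≤-trans; ≤-pred; ≰⇒>; <-irrefl; ≤ᵇ⇒≤; ≤⇒≤ᵇ; <ᵇ⇒<)
open import Data.Bool using (Bool; true; false; _∨_; _∧_; not; if_then_else_; T)
open import Data.Bool.Properties using (∨-zeroʳ; ∧-zeroʳ; ¬-not; not-injective; T-≡; T-∧)
open import Data.Bool.ListAction using (all; any)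
open import Data.Fin using (Fin; toℕ) renaming (_≟_ to _≟F_)
open import Data.Fin.Subset using (Subset; ⁅_⁆; ∣_∣; _-_) renaming (_∈_ to _∈ₛ_)
open import Data.Fin.Subset.Properties
  using (x∈⁅x⁆; x∈⁅y⁆⇒x≡y; x≢y⇒x∉⁅y⁆; ∣⁅x⁆∣≡1; x∈p∧x≢y⇒x∈p-y; x∈p⇒∣p-x∣<∣p∣)
open import Data.Vec using (lookup; updateAt)
open import Data.Vec.Properties using (lookup∘updateAt; lookup∘updateAt′; []=⇒lookup; lookup⇒[]=)
open import Data.List using (List; []; _∷_; map; foldr; length; allFin)
open import Data.List.Membership.Propositional using (_∈_; _∉_; lose; find)
open import Data.List.Membership.Propositional.Properties using (∈-allFin; ∈-map⁺; ∈-map⁻)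
import Data.List.Membership.DecPropositional as DecMembership
open import Data.List.Relation.Unary.Any using (here; there)
open import Data.List.Relation.Unary.Any.Properties using (any⁺; any⁻)
open import Data.List.Relation.Unary.All as All using (All; []; _∷_)
open import Data.List.Relation.Unary.All.Properties using (map⁺; ++⁺; all⁺; all⁻)
open import Data.List.Relation.Unary.AllPairs using (_∷_)
open import Data.List.Relation.Unary.Unique.Propositional using (Unique)
open import Data.List.Relation.Binary.Subset.Propositional using (_⊆_)
open import Data.List.Relation.Binary.Subset.Propositional.Properties using (∷⁺ʳ; xs⊆x∷xs; ⊆-trans)
open import Data.List.Relation.Binary.Permutation.Propositional using (↭-setoid)
open import Data.List.Relation.Binary.Permutation.Setoid (↭-setoid {A = ℕ}) using (↭-reflexive)
open import Data.Product using (_×_; _,_; proj₁; proj₂; ∃)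
open import Data.Product.Properties using (≡-dec)
open import Data.Sum using (inj₁; inj₂; swap)
open import Data.Empty using (⊥)
open import Function using (_∘_; Equivalence)
open import Relation.Binary.PropositionalEquality
open import Relation.Nullary using (¬_; yes; no; contradiction)
open import Relation.Nullary.Decidable using (Dec; ⌊_⌋; isYes≗does; dec-true; toWitness)

private
  variable
    X Y : Set
    n : ℕ

toEq : ∀ {b} → T b → b ≡ true
toEq = Equivalence.to T-≡

fromEq : ∀ {b} → b ≡ true → T b
fromEq = Equivalence.from T-≡

⌊⌋-true : ∀ {P : Set} (p? : Dec P) → P → ⌊ p? ⌋ ≡ true
⌊⌋-true p? p = trans (isYes≗does p?) (dec-true p? p)

filter-map : (p : Y → Bool) (f : X → Y) (xs : List X) →
  boolFilter p (map f xs) ≡ map f (boolFilter (p ∘ f) xs)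
filter-map p f []       = refl
filter-map p f (x ∷ xs) with p (f x)
... | true  = cong (f x ∷_) (filter-map p f xs)
... | false = filter-map p f xs

filter-cong : (p q : X → Bool) {xs : List X} →
  All (λ x → p x ≡ q x) xs → boolFilter p xs ≡ boolFilter q xs
filter-cong p q []                       = refl
filter-cong p q {x ∷ _} (px≡qx ∷ agree) rewrite px≡qx with q x
... | true  = cong (x ∷_) (filter-cong p q agree)
... | false = filter-cong p q agree

filter-absorb : (p q : X → Bool) {xs : List X} →
  All (λ x → p x ≡ true → q x ≡ true) xs →
  boolFilter p (boolFilter q xs) ≡ boolFilter p xs
filter-absorb p q []                    = refl
filter-absorb p q {x ∷ _} (p⇒q ∷ imps) with q x
... | true with p x
...   | true  = cong (x ∷_) (filter-absorb p q imps)
...   | false = filter-absorb p q imps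
filter-absorb p q {x ∷ _} (p⇒q ∷ imps) | false with p x
...   | true  with () ← p⇒q refl
...   | false = filter-absorb p q imps

All-map-filter : {P : Y → Set} (f : X → Y) (q : X → Bool) {xs : List X} →
  All (λ x → q x ≡ true → P (f x)) xs → All P (map f (boolFilter q xs))
All-map-filter f q []                 = []
All-map-filter f q {x ∷ _} (px ∷ pxs) with q x
... | true  = px refl ∷ All-map-filter f q pxs
... | false = All-map-filter f q pxs

∈-filter⁺ : (q : X → Bool) {x : X} {xs : List X} →
  x ∈ xs → q x ≡ true → x ∈ boolFilter q xs
∈-filter⁺ q {xs = _ ∷ _} (here refl) qx rewrite qx = here refl
∈-filter⁺ q {xs = y ∷ _} (there x∈xs) qx with q y
... | true  = there (∈-filter⁺ q x∈xs qx)
... | false = ∈-filter⁺ q x∈xs qx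

any-intro : (p : X → Bool) {x : X} {xs : List X} → x ∈ xs → p x ≡ true → any p xs ≡ true
any-intro p x∈xs px = toEq (any⁺ p (lose x∈xs (fromEq px)))

any-elim : (p : X → Bool) (xs : List X) → any p xs ≡ true → ∃ λ x → x ∈ xs × p x ≡ true
any-elim p xs anyp with x , x∈xs , px ← find (any⁻ p xs (fromEq anyp)) = x , x∈xs , toEq px

any-false : (p : X → Bool) (xs : List X) →
  (∀ {x} → x ∈ xs → p x ≡ true → ⊥) → any p xs ≡ false
any-false p xs none = ¬-not λ anyp → let x , x∈xs , px = any-elim p xs anyp in none x∈xs px

all-intro : (p : X → Bool) (xs : List X) → (∀ {x} → x ∈ xs → p x ≡ true) → all p xs ≡ true
all-intro p xs allp = toEq (all⁻ p (All.tabulate (fromEq ∘ allp)))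

all-elim : (p : X → Bool) (xs : List X) → all p xs ≡ true → ∀ {x} → x ∈ xs → p x ≡ true
all-elim p xs allp x∈xs = toEq (All.lookup (all⁺ p xs (fromEq allp)) x∈xs)

length≤1-unique : {xs : List X} {x y : X} → length xs ≤ 1 → x ∈ xs → y ∈ xs → x ≡ y
length≤1-unique {xs = _ ∷ []}    _        (here refl) (here refl) = refl
length≤1-unique {xs = _ ∷ _ ∷ _} (s≤s ()) _           _

subsets⊆ : (E : List X) → All (_⊆ E) (subsets E)
subsets⊆ []       = (λ ()) ∷ []
subsets⊆ (x ∷ xs) =
  ++⁺ (map⁺ (All.map (∷⁺ʳ x) (subsets⊆ xs)))
      (All.map weaken (subsets⊆ xs))
  where
  weaken : ∀ {A} → A ⊆ xs → A ⊆ x ∷ xs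
  weaken A⊆xs = ⊆-trans A⊆xs (xs⊆x∷xs xs x)

singleton-misses : ∀ {u v : Fin n} → u ≢ v → lookup ⁅ v ⁆ u ≡ false
singleton-misses {u = u} {v} u≢v = ¬-not (x≢y⇒x∉⁅y⁆ u≢v ∘ lookup⇒[]= u ⁅ v ⁆)

two-members : (p : Subset n) {x y : Fin n} → x ≢ y →
  lookup p x ≡ true → lookup p y ≡ true → 2 ≤ ∣ p ∣
two-members p {x} {y} x≢y px py = ≤-trans (s≤s one≤∣p-x∣) (x∈p⇒∣p-x∣<∣p∣ x∈p)
  where
  x∈p : x ∈ₛ p
  x∈p = lookup⇒[]= x p px
  one≤∣p-x∣ : 1 ≤ ∣ p - x ∣
  one≤∣p-x∣ = ≤-trans (s≤s z≤n)
    (x∈p⇒∣p-x∣<∣p∣ (x∈p∧x≢y⇒x∈p-y (lookup⇒[]= y p py) (x≢y ∘ sym)))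

-- The closure step of Defs, spelled out: closeStep A S unfolds to
-- foldr (addEdge S) S A, which marks both endpoints of every edge of A
-- touching S.
mark : Subset n → Fin n → Subset n
mark S i = updateAt S i (λ _ → true)

mark-marks : (S : Subset n) (i : Fin n) → lookup (mark S i) i ≡ true
mark-marks S i = lookup∘updateAt i S

mark-keeps : (S : Subset n) (i j : Fin n) → lookup S j ≡ true → lookup (mark S i) j ≡ true
mark-keeps S i j j∈S with j ≟F i
... | yes refl = mark-marks S i
... | no j≢i   = trans (lookup∘updateAt′ j i j≢i S) j∈S

touchesᵇ : Subset n → Edge n → Bool
touchesᵇ S (a , b) = lookup S a ∨ lookup S b

addEdge : Subset n → Edge n → Subset n → Subset n
addEdge S (a , b) R = if touchesᵇ S (a , b) then mark (mark R a) b else R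

addEdge-keeps : (S : Subset n) (e : Edge n) (R : Subset n) {x : Fin n} →
  lookup R x ≡ true → lookup (addEdge S e R) x ≡ true
addEdge-keeps S (a , b) R {x} x∈R with touchesᵇ S (a , b)
... | true  = mark-keeps (mark R a) b x (mark-keeps R a x x∈R)
... | false = x∈R

addEdge-marks : (S : Subset n) (a b : Fin n) (R : Subset n) → touchesᵇ S (a , b) ≡ true →
  lookup (addEdge S (a , b) R) a ≡ true × lookup (addEdge S (a , b) R) b ≡ true
addEdge-marks S a b R touches with touchesᵇ S (a , b) | touches
... | true | refl = mark-keeps (mark R a) b a (mark-marks R a) , mark-marks (mark R a) b

fold-keeps : (S : Subset n) (L : List (Edge n)) {R : Subset n} {x : Fin n} →
  lookup R x ≡ true → lookup (foldr (addEdge S) R L) x ≡ true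
fold-keeps S []      x∈R = x∈R
fold-keeps S (e ∷ L) x∈R = addEdge-keeps S e _ (fold-keeps S L x∈R)

fold-crosses : (S : Subset n) {L : List (Edge n)} {R : Subset n} {f : Edge n} {v w : Fin n} →
  f ∈ L → Joins f v w → lookup S v ≡ true → lookup (foldr (addEdge S) R L) w ≡ true
fold-crosses S {(a , b) ∷ _} (here refl) (inj₁ (refl , refl)) v∈S =
  proj₂ (addEdge-marks S a b _ (cong (_∨ lookup S b) v∈S))
fold-crosses S {(a , b) ∷ _} (here refl) (inj₂ (refl , refl)) v∈S =
  proj₁ (addEdge-marks S a b _ (trans (cong (lookup S a ∨_) v∈S) (∨-zeroʳ _)))
fold-crosses S {e ∷ _} (there f∈L) J v∈S = addEdge-keeps S e _ (fold-crosses S f∈L J v∈S)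

fold-untouched : (S : Subset n) {L : List (Edge n)} {R : Subset n} →
  All (λ e → touchesᵇ S e ≡ false) L → foldr (addEdge S) R L ≡ R
fold-untouched S [] = refl
fold-untouched S {(a , b) ∷ _} (untouched ∷ rest) with touchesᵇ S (a , b) | untouched
... | false | refl = fold-untouched S rest

iter-self : ∀ (A : List (Edge n)) (v : Fin n) k → lookup (iter k (closeStep A) ⁅ v ⁆) v ≡ true
iter-self A v zero    = []=⇒lookup (x∈⁅x⁆ v)
iter-self A v (suc k) = fold-keeps (iter k (closeStep A) ⁅ v ⁆) A (iter-self A v k)

component-self : (A : List (Edge n)) (v : Fin n) → lookup (component A v) v ≡ true
component-self {n} A v = iter-self A v n

component-neighbour : (A : List (Edge n)) {f : Edge n} {v w : Fin n} →
  f ∈ A → Joins f v w → lookup (component A v) w ≡ true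
component-neighbour {suc m} A {v = v} f∈A J =
  fold-crosses (iter m (closeStep A) ⁅ v ⁆) f∈A J (iter-self A v m)

Isolated : List (Edge n) → Fin n → Set
Isolated A v = All (λ f → incidentᵇ v f ≡ false) A

singleton-untouched : (v : Fin n) (e : Edge n) → incidentᵇ v e ≡ false → touchesᵇ ⁅ v ⁆ e ≡ false
singleton-untouched v (a , b) notIncident with a ≟F v | b ≟F v | notIncident
... | no a≢v | no b≢v | _ = cong₂ _∨_ (singleton-misses a≢v) (singleton-misses b≢v)

component-isolated : (A : List (Edge n)) (v : Fin n) → Isolated A v → component A v ≡ ⁅ v ⁆
component-isolated {n} A v iso = stable n
  where
  stable : ∀ k → iter k (closeStep A) ⁅ v ⁆ ≡ ⁅ v ⁆
  stable zero    = refl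
  stable (suc k) rewrite stable k = fold-untouched ⁅ v ⁆ (All.map (singleton-untouched v _) iso)

singleton-leader : (A : List (Edge n)) (v : Fin n) → component A v ≡ ⁅ v ⁆ → leaderᵇ A v ≡ true
singleton-leader {n} A v comp≡ = cong not (any-false _ (allFin n) smaller-member)
  where
  smaller-member : ∀ {u} → u ∈ allFin n →
    ((toℕ u <ᵇ toℕ v) ∧ lookup (component A v) u) ≡ true → ⊥
  smaller-member {u} _ h rewrite comp≡ with Equivalence.to T-∧ (fromEq h)
  ... | u<v , u∈⁅v⁆ =
    <-irrefl (cong toℕ (x∈⁅y⁆⇒x≡y v (lookup⇒[]= u ⁅ v ⁆ (toEq u∈⁅v⁆)))) (<ᵇ⇒< _ _ u<v)

isolated⇒hasX1 : (A : List (Edge n)) (v : Fin n) → Isolated A v → hasX1 (compPartition A) ≡ true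
isolated⇒hasX1 A v iso =
  any-intro _ (∈-map⁺ (λ u → ∣ component A u ∣)
                (∈-filter⁺ (leaderᵇ A) (∈-allFin v) (singleton-leader A v comp≡)))
              size≡1
  where
  comp≡ : component A v ≡ ⁅ v ⁆
  comp≡ = component-isolated A v iso
  size≡1 : ⌊ ∣ component A v ∣ ≟ 1 ⌋ ≡ true
  size≡1 rewrite comp≡ | ∣⁅x⁆∣≡1 v = refl

large-components⇒noX1 : (A : List (Edge n)) →
  (∀ v → 2 ≤ ∣ component A v ∣) → hasX1 (compPartition A) ≡ false
large-components⇒noX1 A large = any-false (λ i → ⌊ i ≟ 1 ⌋) (compPartition A) λ part∈λ part≡1 →
  let v , _ , part≡size = ∈-map⁻ (λ u → ∣ component A u ∣) part∈λ
  in 2≰1 (subst (2 ≤_) (trans (sym part≡size) (toWitness (fromEq part≡1))) (large v))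
  where
  2≰1 : ¬ 2 ≤ 1
  2≰1 (s≤s ())

internal⇒internalᵇ : (E : List (Edge n)) {v : Fin n} → Internal E v → internalᵇ E v ≡ true
internal⇒internalᵇ E 2≤deg = toEq (≤⇒≤ᵇ 2≤deg)

non-internal-edge-unique : (E : List (Edge n)) {v : Fin n} {e f : Edge n} →
  internalᵇ E v ≡ false → e ∈ E → f ∈ E → incidentᵇ v e ≡ true → incidentᵇ v f ≡ true → e ≡ f
non-internal-edge-unique E {v} notInternal e∈E f∈E e-at-v f-at-v =
  length≤1-unique deg≤1 (∈-filter⁺ _ e∈E e-at-v) (∈-filter⁺ _ f∈E f-at-v)
  where
  deg≤1 : deg E v ≤ 1
  deg≤1 = ≤-pred (≰⇒> λ 2≤deg →
    contradiction (trans (sym (internal⇒internalᵇ E 2≤deg)) notInternal) λ ())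

joins-incident : {f : Edge n} {v w : Fin n} → Joins f v w → incidentᵇ v f ≡ true
joins-incident {v = v} {w} (inj₁ (refl , refl)) = cong (_∨ ⌊ w ≟F v ⌋) (⌊⌋-true (v ≟F v) refl)
joins-incident {v = v} {w} (inj₂ (refl , refl)) =
  trans (cong (⌊ w ≟F v ⌋ ∨_) (⌊⌋-true (v ≟F v) refl)) (∨-zeroʳ _)

leaf-at-non-internal : (E : List (Edge n)) {f : Edge n} {v w : Fin n} →
  Joins f v w → internalᵇ E v ≡ false → leafEdgeᵇ E f ≡ true
leaf-at-non-internal E (inj₁ (refl , refl)) notInternal rewrite notInternal = refl
leaf-at-non-internal E (inj₂ (refl , refl)) notInternal rewrite notInternal = cong not (∧-zeroʳ _)

leaf-edge-end : (E : List (Edge n)) (e : Edge n) → leafEdgeᵇ E e ≡ true →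
  ∃ λ v → internalᵇ E v ≡ false × incidentᵇ v e ≡ true
leaf-edge-end E (a , b) leaf with internalᵇ E a in ia | internalᵇ E b in ib | leaf
... | false | _     | _ = a , ia , joins-incident {w = b} (inj₁ (refl , refl))
... | true  | false | _ = b , ib , joins-incident {w = a} (inj₂ (refl , refl))

-- containsLeavesᵇ E A checks, for each edge e of E, the condition below.
sameEdgeᵇ : Edge n → Edge n → Bool
sameEdgeᵇ (a , b) (c , d) = ⌊ a ≟F c ⌋ ∧ ⌊ b ≟F d ⌋

leafCoveredᵇ : List (Edge n) → List (Edge n) → Edge n → Bool
leafCoveredᵇ E A e = not (leafEdgeᵇ E e) ∨ any (sameEdgeᵇ e) A

sameEdge-refl : (e : Edge n) → sameEdgeᵇ e e ≡ true
sameEdge-refl (a , b) = cong₂ _∧_ (⌊⌋-true (a ≟F a) refl) (⌊⌋-true (b ≟F b) refl)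

sameEdge-sound : (e f : Edge n) → sameEdgeᵇ e f ≡ true → e ≡ f
sameEdge-sound (a , b) (c , d) same with Equivalence.to T-∧ (fromEq same)
... | a≡c , b≡d = cong₂ _,_ (toWitness {a? = a ≟F c} a≡c) (toWitness {a? = b ≟F d} b≡d)

containsLeaves-intro : (E A : List (Edge n)) →
  (∀ {e} → e ∈ E → leafEdgeᵇ E e ≡ true → e ∈ A) → containsLeavesᵇ E A ≡ true
containsLeaves-intro E A leaves⊆A = all-intro (leafCoveredᵇ E A) E covered
  where
  covered : ∀ {e} → e ∈ E → leafCoveredᵇ E A e ≡ true
  covered {e} e∈E with leafEdgeᵇ E e in leaf
  ... | false = refl
  ... | true  = any-intro (sameEdgeᵇ e) (leaves⊆A e∈E leaf) (sameEdge-refl e)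

containsLeaves-elim : (E A : List (Edge n)) → containsLeavesᵇ E A ≡ true →
  ∀ {e} → e ∈ E → leafEdgeᵇ E e ≡ true → e ∈ A
containsLeaves-elim E A contains {e} e∈E leaf
  with all-elim (leafCoveredᵇ E A) E contains e∈E
... | covered rewrite leaf with any-elim (sameEdgeᵇ e) A covered
... | f , f∈A , same = subst (_∈ A) (sym (sameEdge-sound e f same)) f∈A

omitted-leaf-isolates : (E A : List (Edge n)) → A ⊆ E → {e : Edge n} →
  e ∈ E → leafEdgeᵇ E e ≡ true → e ∉ A → ∃ (Isolated A)
omitted-leaf-isolates E A A⊆E {e} e∈E leaf e∉A with leaf-edge-end E e leaf
... | v , notInternal , e-at-v = v , All.tabulate only-e-at-v
  where
  only-e-at-v : ∀ {f} → f ∈ A → incidentᵇ v f ≡ false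
  only-e-at-v f∈A = ¬-not λ f-at-v →
    e∉A (subst (_∈ A) (non-internal-edge-unique E notInternal (A⊆E f∈A) e∈E f-at-v e-at-v) f∈A)

noX1⇒containsLeaves : (E A : List (Edge n)) → A ⊆ E →
  hasX1 (compPartition A) ≡ false → containsLeavesᵇ E A ≡ true
noX1⇒containsLeaves E A A⊆E noX1 = containsLeaves-intro E A leaf∈A
  where
  leaf∈A : ∀ {e} → e ∈ E → leafEdgeᵇ E e ≡ true → e ∈ A
  leaf∈A {e} e∈E leaf with DecMembership._∈?_ (≡-dec _≟F_ _≟F_) e A
  ... | yes e∈A = e∈A
  ... | no e∉A  =
    let v , iso = omitted-leaf-isolates E A A⊆E e∈E leaf e∉A
    in contradiction (trans (sym (isolated⇒hasX1 A v iso)) noX1) λ ()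

walk-leaves : {F : List (Edge n)} {v u : Fin n} → Walk F v u → v ≢ u →
  ∃ λ w → ∃ λ f → f ∈ F × Joins f v w × w ≢ v
walk-leaves here v≢u = contradiction refl v≢u
walk-leaves {v = v} (step {v = w} f f∈F J rest) v≢u with w ≟F v
... | yes refl = walk-leaves rest v≢u
... | no w≢v   = w , f , f∈F , J , w≢v

another-vertex : (E : List (Edge n)) → IsCaterpillar n E → (v : Fin n) → ∃ λ u → v ≢ u
another-vertex E C v = pick spineList nontriv distinct
  where
  open IsCaterpillar C using (spineList; nontriv; distinct)
  pick : (xs : List (Fin _)) → 2 ≤ length xs → Unique xs → ∃ λ u → v ≢ u
  pick []          ()               _
  pick (_ ∷ [])    (s≤s ())         _
  pick (x ∷ y ∷ _) _ ((x≢y ∷ _) ∷ _) with v ≟F x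
  ... | yes refl = y , x≢y
  ... | no v≢x   = x , v≢x

-- In a proper caterpillar every vertex v lies on a leaf-edge to another vertex:
-- a non-internal v on any of its edges, an internal v on the edge to its leaf.
leaf-neighbour : (E : List (Edge n)) → IsCaterpillar n E → Proper E → (v : Fin n) →
  ∃ λ w → ∃ λ f → f ∈ E × Joins f v w × w ≢ v × leafEdgeᵇ E f ≡ true
leaf-neighbour E C P v with internalᵇ E v in internal
... | false =
  let u , v≢u = another-vertex E C v
      w , f , f∈E , J , w≢v = walk-leaves (IsTree.connected (IsCaterpillar.tree C) v u) v≢u
  in w , f , f∈E , J , w≢v , leaf-at-non-internal E J internal
... | true =
  let w , deg≡1 , f , f∈E , J = P v (≤ᵇ⇒≤ 2 _ (fromEq internal))
      w-notInternal : internalᵇ E w ≡ false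
      w-notInternal = cong (2 ≤ᵇ_) deg≡1
      w≢v : w ≢ v
      w≢v = λ w≡v → contradiction
              (trans (sym internal) (subst (λ u → internalᵇ E u ≡ false) w≡v w-notInternal)) λ ()
  in w , f , f∈E , J , w≢v , leaf-at-non-internal E (swap J) w-notInternal

containsLeaves⇒noX1 : (E A : List (Edge n)) → IsCaterpillar n E → Proper E →
  containsLeavesᵇ E A ≡ true → hasX1 (compPartition A) ≡ false
containsLeaves⇒noX1 E A C P contains = large-components⇒noX1 A large
  where
  large : ∀ v → 2 ≤ ∣ component A v ∣
  large v =
    let w , f , f∈E , J , w≢v , leaf = leaf-neighbour E C P v
    in two-members (component A v) w≢v
         (component-neighbour A (containsLeaves-elim E A contains f∈E leaf) J)
         (component-self A v)

containsLeaves≡noX1 : (E A : List (Edge n)) → IsCaterpillar n E → Proper E → A ⊆ E →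
  containsLeavesᵇ E A ≡ not (hasX1 (compPartition A))
containsLeaves≡noX1 E A C P A⊆E with containsLeavesᵇ E A in contains
... | true rewrite containsLeaves⇒noX1 E A C P contains = refl
... | false with hasX1 (compPartition A) in x1
...   | true  = refl
...   | false = contradiction (trans (sym contains) (noX1⇒containsLeaves E A A⊆E x1)) λ ()

proposition2p1 : ∀ (n : ℕ) (E : List (Edge n)) → IsCaterpillar n E →
    (evalX1≡0 (U E) ≈ₚ evalX1≡0 (UL E)) ×
    (Proper E → IndepX1 (UL E) × (UL E ≈ₚ evalX1≡0 (U E)))
proposition2p1 n E C =
    ↭-reflexive survivors-agree
  , λ P → All-map-filter compPartition leavesIn
             (All.map {P = _⊆ E} (λ {A} _ → containsLeaves⇒noX1 E A C P) (subsets⊆ E))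
        , ↭-reflexive (restricted-is-evaluation P)
  where
  open ≡-Reasoning
  noX1 : Monomial → Bool
  noX1 m = not (hasX1 m)
  leavesIn : List (Edge n) → Bool
  leavesIn = containsLeavesᵇ E

  survivors-contain-leaves :
    All (λ A → noX1 (compPartition A) ≡ true → leavesIn A ≡ true) (subsets E)
  survivors-contain-leaves =
    All.map {P = _⊆ E} (λ {A} A⊆E → noX1⇒containsLeaves E A A⊆E ∘ not-injective) (subsets⊆ E)

  survivors-agree : evalX1≡0 (U E) ≡ evalX1≡0 (UL E)
  survivors-agree = begin
    evalX1≡0 (U E)
      ≡⟨ filter-map noX1 compPartition (subsets E) ⟩
    map compPartition (boolFilter (noX1 ∘ compPartition) (subsets E))
      ≡⟨ cong (map compPartition)
           (filter-absorb (noX1 ∘ compPartition) leavesIn survivors-contain-leaves) ⟨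
    map compPartition (boolFilter (noX1 ∘ compPartition) (boolFilter leavesIn (subsets E)))
      ≡⟨ filter-map noX1 compPartition (boolFilter leavesIn (subsets E)) ⟨
    evalX1≡0 (UL E) ∎

  restricted-is-evaluation : Proper E → UL E ≡ evalX1≡0 (U E)
  restricted-is-evaluation P = begin
    map compPartition (boolFilter leavesIn (subsets E))
      ≡⟨ cong (map compPartition) (filter-cong leavesIn (noX1 ∘ compPartition)
           (All.map {P = _⊆ E} (λ {A} → containsLeaves≡noX1 E A C P) (subsets⊆ E))) ⟩
    map compPartition (boolFilter (noX1 ∘ compPartition) (subsets E))
      ≡⟨ filter-map noX1 compPartition (subsets E) ⟨
    evalX1≡0 (U E) ∎
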